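{- There is a function $D:\mathbb{N}^2\rightarrow\mathbb{N}$ such that for all $r,\lambda\in\mathbb{N}$, every bipartite graph of average degree at least $D(r,\lambda)$ has an induced bipartite subgraph with bipartition $(A,B)$ such that $A$ is $r$-regular and $|A|\geq\lambda|B|$.
   Context: All graphs are finite and simple. For a bipartite graph with bipartition $(A,B)$ and a positive integer $r$, "$A$ is $r$-regular" means that $A$ is non-empty and every vertex of $A$ has degree exactly $r$ (in the bipartite graph under consideration). -}

module Defs where

open import Data.Nat using (ℕ; zero; suc; _+_; _*_; _≤_; _<_)
open import Data.Bool using (Bool; true; false; _∧_; _∨_; if_then_else_)
open import Data.Fin using (Fin; zero; suc)
open import Data.Product using (Σ; ∃; _×_; _,_)
open import Relation.Binary.PropositionalEquality using (_≡_; _≢_)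

count : {n : ℕ} → (Fin n → Bool) → ℕ
count {zero}  p = 0
count {suc n} p = (if p zero then 1 else 0) + count (λ i → p (suc i))

sumFin : {n : ℕ} → (Fin n → ℕ) → ℕ
sumFin {zero}  f = 0
sumFin {suc n} f = f zero + sumFin (λ i → f (suc i))

record Graph : Set where
  field
    n      : ℕ
    adj    : Fin n → Fin n → Bool
    sym    : ∀ u v → adj u v ≡ adj v u
    irrefl : ∀ v → adj v v ≡ false
open Graph public

IsBipartite : Graph → Set
IsBipartite G = Σ (Fin (n G) → Bool) λ col →
  ∀ u v → adj G u v ≡ true → col u ≢ col v

degree : (G : Graph) → Fin (n G) → ℕ
degree G v = count (adj G v)

AvgDegreeAtLeast : Graph → ℕ → Set
AvgDegreeAtLeast G d = (1 ≤ n G) × (d * n G ≤ sumFin (degree G))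

-- Given vertex subsets A and B of G (as Boolean predicates), the induced
-- subgraph G[A ∪ B] is bipartite with bipartition (A , B):
-- A and B disjoint, each independent in G.
IsInducedBipartition : (G : Graph) → (Fin (n G) → Bool) → (Fin (n G) → Bool) → Set
IsInducedBipartition G A B =
  (∀ v → A v ≡ true → B v ≡ false) ×
  (∀ u v → A u ≡ true → A v ≡ true → adj G u v ≡ false) ×
  (∀ u v → B u ≡ true → B v ≡ true → adj G u v ≡ false)

inducedDegree : (G : Graph) → (Fin (n G) → Bool) → Fin (n G) → ℕ
inducedDegree G S v = count (λ u → adj G v u ∧ S u)

RegularSide : (G : Graph) → (A B : Fin (n G) → Bool) → ℕ → Set
RegularSide G A B r =
  (1 ≤ count A) ×
  (∀ v → A v ≡ true → inducedDegree G (λ u → A u ∨ B u) v ≡ r)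

module Submission where

-- Proof strategy (r ≥ 1; for r = 0 a single vertex and B = ∅ suffice).
-- Fix a proper 2-colouring. Starting from the whole graph, which has at least
-- M·|V| edges, repeatedly delete from the larger colour class X all vertices
-- of degree below 8·e(S)/|S| as long as this increases the edge density. The
-- process ends in a "stable" set S whose density is still ≥ M; there a linear
-- computation shows that the X-vertices of medium degree, between E/(4N) and
-- 8E/N, carry a constant fraction of the edges. Choose B ⊆ Y at random,
-- keeping each vertex with probability 1/q, q ≈ 16E/N. A medium vertex then has
-- exactly r neighbours in B with probability ≥ d/(Kc·q), so the expected number
-- of such vertices exceeds λ times the expected size of B, and some B realises
-- this; A is the set of those vertices. Probabilities are handled in integer
-- arithmetic by weighting each subset B ⊆ Y with Q^|Y∖B| (Q = q - 1).

open import Defs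
open import Data.Nat hiding (_≟_)
open import Data.Nat.Properties hiding (_≟_)
open import Data.Nat.DivMod using (_/_; _%_; m≡m%n+[m/n]*n; m%n<n)
open import Data.Nat.Tactic.RingSolver using (solve-∀)
open import Data.Bool using (Bool; true; false; _∧_; _∨_; not; if_then_else_; T)
open import Data.Bool.Properties using (not-involutive; not-¬; ∧-zeroʳ)
open import Data.Fin using (Fin; zero; suc; _≟_; fromℕ<)
open import Data.Product using (Σ; _×_; _,_; proj₁; proj₂)
open import Data.Unit using (tt)
open import Data.Empty using (⊥-elim)
open import Function using (_∘_)
open import Relation.Nullary using (does; yes; no)
open import Relation.Nullary.Decidable using (dec-true)
open import Relation.Binary.PropositionalEquality renaming (sym to sym≡)
import Algebra.Properties.Semiring.Sum +-*-semiring as Σℕ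

ind : Bool → ℕ
ind b = if b then 1 else 0

ind-∧ : ∀ a b → ind (a ∧ b) ≡ ind a * ind b
ind-∧ true  b = sym≡ (+-identityʳ (ind b))
ind-∧ false b = refl

-- sumFin is the standard library's finite sum over the semiring ℕ, which
-- lets us import linearity and the interchange of summations.
sumFin≡sum : ∀ {n} (f : Fin n → ℕ) → sumFin f ≡ Σℕ.sum f
sumFin≡sum {zero}  f = refl
sumFin≡sum {suc n} f = cong (f zero +_) (sumFin≡sum (λ i → f (suc i)))

sumFin-cong : ∀ {n} {f g : Fin n → ℕ} → (∀ i → f i ≡ g i) → sumFin f ≡ sumFin g
sumFin-cong {zero}  e = refl
sumFin-cong {suc n} e = cong₂ _+_ (e zero) (sumFin-cong (λ i → e (suc i)))

sumFin-mono : ∀ {n} {f g : Fin n → ℕ} → (∀ i → f i ≤ g i) → sumFin f ≤ sumFin g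
sumFin-mono {zero}  e = z≤n
sumFin-mono {suc n} e = +-mono-≤ (e zero) (sumFin-mono (λ i → e (suc i)))

sumFin-+ : ∀ {n} (f g : Fin n → ℕ) → sumFin (λ i → f i + g i) ≡ sumFin f + sumFin g
sumFin-+ f g = begin
  sumFin (λ i → f i + g i)  ≡⟨ sumFin≡sum (λ i → f i + g i) ⟩
  Σℕ.sum (λ i → f i + g i)  ≡⟨ Σℕ.∑-distrib-+ f g ⟩
  Σℕ.sum f + Σℕ.sum g       ≡⟨ sym≡ (cong₂ _+_ (sumFin≡sum f) (sumFin≡sum g)) ⟩
  sumFin f + sumFin g       ∎
  where open ≡-Reasoning

sumFin-*ˡ : ∀ {n} (k : ℕ) (f : Fin n → ℕ) → sumFin (λ i → k * f i) ≡ k * sumFin f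
sumFin-*ˡ k f = begin
  sumFin (λ i → k * f i)  ≡⟨ sumFin≡sum (λ i → k * f i) ⟩
  Σℕ.sum (λ i → k * f i)  ≡⟨ sym≡ (Σℕ.*-distribˡ-sum k f) ⟩
  k * Σℕ.sum f            ≡⟨ cong (k *_) (sym≡ (sumFin≡sum f)) ⟩
  k * sumFin f            ∎
  where open ≡-Reasoning

sumFin-*ʳ : ∀ {n} (k : ℕ) (f : Fin n → ℕ) → sumFin (λ i → f i * k) ≡ sumFin f * k
sumFin-*ʳ k f = begin
  sumFin (λ i → f i * k)  ≡⟨ sumFin-cong (λ i → *-comm (f i) k) ⟩
  sumFin (λ i → k * f i)  ≡⟨ sumFin-*ˡ k f ⟩
  k * sumFin f            ≡⟨ *-comm k (sumFin f) ⟩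
  sumFin f * k            ∎
  where open ≡-Reasoning

sumFin-swap : ∀ {m n} (F : Fin m → Fin n → ℕ) →
  sumFin (λ i → sumFin (F i)) ≡ sumFin (λ j → sumFin (λ i → F i j))
sumFin-swap F = begin
  sumFin (λ i → sumFin (F i))                  ≡⟨ sumFin-cong (λ i → sumFin≡sum (F i)) ⟩
  sumFin (λ i → Σℕ.sum (F i))                  ≡⟨ sumFin≡sum (λ i → Σℕ.sum (F i)) ⟩
  Σℕ.sum (λ i → Σℕ.sum (F i))                  ≡⟨ Σℕ.∑-comm F ⟩
  Σℕ.sum (λ j → Σℕ.sum (λ i → F i j))          ≡⟨ sym≡ (sumFin≡sum (λ j → Σℕ.sum (λ i → F i j))) ⟩
  sumFin (λ j → Σℕ.sum (λ i → F i j))          ≡⟨ sumFin-cong (λ j → sym≡ (sumFin≡sum (λ i → F i j))) ⟩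
  sumFin (λ j → sumFin (λ i → F i j))          ∎
  where open ≡-Reasoning

count≡sumFin : ∀ {n} (p : Fin n → Bool) → count p ≡ sumFin (λ i → ind (p i))
count≡sumFin {zero}  p = refl
count≡sumFin {suc n} p = cong (ind (p zero) +_) (count≡sumFin (λ i → p (suc i)))

count-cong : ∀ {n} {p q : Fin n → Bool} → (∀ i → p i ≡ q i) → count p ≡ count q
count-cong {zero}  e = refl
count-cong {suc n} e = cong₂ _+_ (cong ind (e zero)) (count-cong (λ i → e (suc i)))

count-mono : ∀ {n} {p q : Fin n → Bool} → (∀ i → p i ≡ true → q i ≡ true) → count p ≤ count q
count-mono {zero}  h = z≤n
count-mono {suc n} {p} {q} h = +-mono-≤ (ind-mono (p zero) (q zero) (h zero)) (count-mono (λ i → h (suc i)))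
  where
  ind-mono : ∀ a b → (a ≡ true → b ≡ true) → ind a ≤ ind b
  ind-mono false b _ = z≤n
  ind-mono true  b f rewrite f refl = ≤-refl

count-split : ∀ {n} (p r : Fin n → Bool) →
  count p ≡ count (λ u → p u ∧ r u) + count (λ u → p u ∧ not (r u))
count-split {zero}  p r = refl
count-split {suc n} p r = trans (cong (ind (p zero) +_) (count-split (λ i → p (suc i)) (λ i → r (suc i))))
  (split-head (p zero) (r zero) _ _)
  where
  split-head : ∀ a b x y → ind a + (x + y) ≡ (ind (a ∧ b) + x) + (ind (a ∧ not b) + y)
  split-head false b x y = refl
  split-head true  true x y = refl
  split-head true  false x y = sym≡ (+-suc x y)

count-none : ∀ {n} → count {n} (λ _ → false) ≡ 0
count-none {zero}  = refl
count-none {suc n} = count-none {n}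

count-all : ∀ {n} → count {n} (λ _ → true) ≡ n
count-all {zero}  = refl
count-all {suc n} = cong suc (count-all {n})

count-pos : ∀ {n} (p : Fin n → Bool) (v : Fin n) → p v ≡ true → 1 ≤ count p
count-pos p zero    e rewrite e = s≤s z≤n
count-pos p (suc v) e = ≤-trans (count-pos (λ i → p (suc i)) v e) (m≤n+m _ (ind (p zero)))

sum-over-≥ : ∀ {n} (p : Fin n → Bool) (f : Fin n → ℕ) (k : ℕ) →
  (∀ i → p i ≡ true → k ≤ f i) → count p * k ≤ sumFin (λ i → ind (p i) * f i)
sum-over-≥ p f k h = begin
  count p * k                        ≡⟨ cong (_* k) (count≡sumFin p) ⟩
  sumFin (λ i → ind (p i)) * k       ≡⟨ sym≡ (sumFin-*ʳ k (λ i → ind (p i))) ⟩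
  sumFin (λ i → ind (p i) * k)       ≤⟨ sumFin-mono (λ i → scaled (p i) (h i)) ⟩
  sumFin (λ i → ind (p i) * f i)     ∎
  where
  open ≤-Reasoning
  scaled : ∀ {x} b → (b ≡ true → k ≤ x) → ind b * k ≤ ind b * x
  scaled true  g = *-monoʳ-≤ 1 (g refl)
  scaled false g = z≤n

sum-over-≤ : ∀ {n} (p : Fin n → Bool) (f : Fin n → ℕ) (k : ℕ) →
  (∀ i → p i ≡ true → f i ≤ k) → sumFin (λ i → ind (p i) * f i) ≤ count p * k
sum-over-≤ p f k h = begin
  sumFin (λ i → ind (p i) * f i)     ≤⟨ sumFin-mono (λ i → scaled (p i) (h i)) ⟩
  sumFin (λ i → ind (p i) * k)       ≡⟨ sumFin-*ʳ k (λ i → ind (p i)) ⟩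
  sumFin (λ i → ind (p i)) * k       ≡⟨ cong (_* k) (sym≡ (count≡sumFin p)) ⟩
  count p * k                        ∎
  where
  open ≤-Reasoning
  scaled : ∀ {x} b → (b ≡ true → x ≤ k) → ind b * x ≤ ind b * k
  scaled true  g = *-monoʳ-≤ 1 (g refl)
  scaled false g = z≤n

^-distribʳ-* : ∀ a b k → (a * b) ^ k ≡ a ^ k * b ^ k
^-distribʳ-* a b zero    = refl
^-distribʳ-* a b (suc k) rewrite ^-distribʳ-* a b k = interchange a b (a ^ k) (b ^ k)
  where
  interchange : ∀ a b x y → a * b * (x * y) ≡ a * x * (b * y)
  interchange = solve-∀

-- The constant in the lower bound for exactly r = k + 1 successes.
Kc : ℕ → ℕ
Kc k = suc k ! * 2 ^ suc k * 2 * 128 ^ k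

module BinomialWeights (Q : ℕ) where

  q : ℕ
  q = suc Q

  -- bw d k = C(d,k)·Q^(d-k): the total weight of the k-subsets of a d-set
  -- when every excluded element has weight Q (Pascal's recursion).
  bw : ℕ → ℕ → ℕ
  bw zero    zero    = 1
  bw zero    (suc k) = 0
  bw (suc d) zero    = Q * bw d zero
  bw (suc d) (suc k) = bw d k + Q * bw d (suc k)

  bw-zero : ∀ d → bw d zero ≡ Q ^ d
  bw-zero zero    = refl
  bw-zero (suc d) = cong (Q *_) (bw-zero d)

  -- (Ring identities mentioning Q take it as an argument, so that the
  -- ring solver treats it as a variable.)
  private
    distribute : ∀ Q k a b → suc k * (a + Q * b) ≡ suc k * a + Q * (suc k * b)
    distribute = solve-∀

  bw-absorb : ∀ d k → suc k * bw (suc d) (suc k) ≡ suc d * bw d k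
  bw-absorb zero    zero    rewrite *-zeroʳ Q = refl
  bw-absorb zero    (suc k) rewrite *-zeroʳ Q | *-zeroʳ k = refl
  bw-absorb (suc d) zero = begin
    1 * (Q * bw d zero + Q * bw (suc d) 1)        ≡⟨ distribute Q 0 (Q * bw d zero) (bw (suc d) 1) ⟩
    1 * (Q * bw d zero) + Q * (1 * bw (suc d) 1)  ≡⟨ cong (λ z → 1 * (Q * bw d zero) + Q * z) (bw-absorb d zero) ⟩
    1 * (Q * bw d zero) + Q * (suc d * bw d zero) ≡⟨ collect Q (bw d zero) d ⟩
    suc (suc d) * (Q * bw d zero)                 ∎
    where
    open ≡-Reasoning
    collect : ∀ Q h d → 1 * (Q * h) + Q * (suc d * h) ≡ suc (suc d) * (Q * h)
    collect = solve-∀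
  bw-absorb (suc d) (suc k) = begin
    suc (suc k) * (bw (suc d) (suc k) + Q * bw (suc d) (suc (suc k)))
      ≡⟨ distribute Q (suc k) (bw (suc d) (suc k)) (bw (suc d) (suc (suc k))) ⟩
    suc (suc k) * bw (suc d) (suc k) + Q * (suc (suc k) * bw (suc d) (suc (suc k)))
      ≡⟨ cong (λ z → suc (suc k) * bw (suc d) (suc k) + Q * z) (bw-absorb d (suc k)) ⟩
    suc (suc k) * bw (suc d) (suc k) + Q * (suc d * bw d (suc k))
      ≡⟨ cong (_+ Q * (suc d * bw d (suc k))) (cong (bw (suc d) (suc k) +_) (bw-absorb d k)) ⟩
    bw (suc d) (suc k) + suc d * bw d k + Q * (suc d * bw d (suc k))
      ≡⟨ collect Q (bw (suc d) (suc k)) d (bw d k) (bw d (suc k)) ⟩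
    bw (suc d) (suc k) + suc d * bw (suc d) (suc k)
      ∎
    where
    open ≡-Reasoning
    collect : ∀ Q x d a z → x + suc d * a + Q * (suc d * z) ≡ x + suc d * (a + Q * z)
    collect = solve-∀

  -- (j+1)^r·Q^j ≤ r!·C(j+r,r)·Q^j, from C(j+r,r) ≥ (j+1)^r / r!.
  bw-lower : ∀ j r → suc j ^ r * Q ^ j ≤ r ! * bw (j + r) r
  bw-lower j zero rewrite +-identityʳ j | bw-zero j | +-identityʳ (Q ^ j) = ≤-refl
  bw-lower j (suc r) rewrite +-suc j r = begin
    suc j * suc j ^ r * Q ^ j                    ≡⟨ *-assoc (suc j) (suc j ^ r) (Q ^ j) ⟩
    suc j * (suc j ^ r * Q ^ j)                  ≤⟨ *-monoʳ-≤ (suc j) (bw-lower j r) ⟩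
    suc j * (r ! * bw (j + r) r)                 ≤⟨ *-monoˡ-≤ (r ! * bw (j + r) r) (s≤s (m≤m+n j r)) ⟩
    suc (j + r) * (r ! * bw (j + r) r)           ≡⟨ swap (suc (j + r)) (r !) (bw (j + r) r) ⟩
    r ! * (suc (j + r) * bw (j + r) r)           ≡⟨ cong (r ! *_) (sym≡ (bw-absorb (j + r) r)) ⟩
    r ! * (suc r * bw (suc (j + r)) (suc r))     ≡⟨ swap (r !) (suc r) (bw (suc (j + r)) (suc r)) ⟩
    suc r * (r ! * bw (suc (j + r)) (suc r))     ≡⟨ sym≡ (*-assoc (suc r) (r !) _) ⟩
    suc r * r ! * bw (suc (j + r)) (suc r)       ∎
    where
    open ≤-Reasoning
    swap : ∀ a b c → a * (b * c) ≡ b * (a * c)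
    swap = solve-∀

  -- A discrete Bernoulli inequality: q^j·t ≤ q·Q^j whenever j + t = q,
  -- i.e. (1 + 1/Q)^j ≤ q / (q - j).
  pow-ratio : ∀ j t → j + t ≡ q → q ^ j * t ≤ q * Q ^ j
  pow-ratio zero t e rewrite +-identityʳ t | e | *-identityʳ q = ≤-refl
  pow-ratio (suc j) t e = begin
    q * q ^ j * t           ≡⟨ expand Q t (q ^ j) ⟩
    q ^ j * (t + Q * t)     ≤⟨ *-monoʳ-≤ (q ^ j) (+-monoˡ-≤ (Q * t) t≤Q) ⟩
    q ^ j * (Q + Q * t)     ≡⟨ factor Q t (q ^ j) ⟩
    Q * (q ^ j * suc t)     ≤⟨ *-monoʳ-≤ Q (pow-ratio j (suc t) (trans (+-suc j t) e)) ⟩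
    Q * (q * Q ^ j)         ≡⟨ *-comm Q (q * Q ^ j) ⟩
    q * Q ^ j * Q           ≡⟨ *-assoc q (Q ^ j) Q ⟩
    q * (Q ^ j * Q)         ≡⟨ cong (q *_) (*-comm (Q ^ j) Q) ⟩
    q * (Q * Q ^ j)         ∎
    where
    open ≤-Reasoning
    expand : ∀ Q t x → suc Q * x * t ≡ x * (t + Q * t)
    expand = solve-∀
    factor : ∀ Q t x → x * (Q + Q * t) ≡ Q * (x * suc t)
    factor = solve-∀
    t≤Q : t ≤ Q
    t≤Q = ≤-trans (m≤n+m t j) (≤-reflexive (suc-injective e))

  pow-ratio-≤2 : ∀ j → 2 * j ≤ q → q ^ j ≤ 2 * Q ^ j
  pow-ratio-≤2 j 2j≤q = *-cancelˡ-≤ q (begin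
    q * q ^ j          ≤⟨ ≤-trans (≤-reflexive (*-comm q (q ^ j))) (*-monoʳ-≤ (q ^ j) q≤2t) ⟩
    q ^ j * (2 * t)    ≡⟨ rearrange (q ^ j) t ⟩
    2 * (q ^ j * t)    ≤⟨ *-monoʳ-≤ 2 (pow-ratio j t j+t≡q) ⟩
    2 * (q * Q ^ j)    ≡⟨ rearrange′ q (Q ^ j) ⟩
    q * (2 * Q ^ j)    ∎)
    where
    open ≤-Reasoning
    t = q ∸ j
    j+t≡q : j + t ≡ q
    j+t≡q = m+[n∸m]≡n (≤-trans (m≤m+n j (j + 0)) 2j≤q)
    q≤2t : q ≤ 2 * t
    q≤2t = begin
      q             ≡⟨ sym≡ j+t≡q ⟩
      j + t         ≤⟨ +-monoˡ-≤ t (+-cancelˡ-≤ j j t (≤-trans 2j≤q′ (≤-reflexive (sym≡ j+t≡q)))) ⟩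
      t + t         ≡⟨ cong (t +_) (sym≡ (+-identityʳ t)) ⟩
      2 * t         ∎
      where
      2j≤q′ : j + j ≤ q
      2j≤q′ = ≤-trans (≤-reflexive (cong (j +_) (sym≡ (+-identityʳ j)))) 2j≤q
    rearrange : ∀ x t → x * (2 * t) ≡ 2 * (x * t)
    rearrange = solve-∀
    rearrange′ : ∀ x y → 2 * (x * y) ≡ x * (2 * y)
    rearrange′ = solve-∀

  -- Exactly r = k + 1 of d trials succeed with probability at least d/(Kc·q)
  -- when each trial succeeds with probability 1/q, r ≤ d - r and 2d ≤ q ≤ 128d;
  -- in weights: d·q^d ≤ Kc·bw d r·q.
  exactly-r-lower : ∀ j k → suc k ≤ j → 2 * (j + suc k) ≤ q → q ≤ 128 * (j + suc k) →
     (j + suc k) * q ^ (j + suc k) ≤ Kc k * bw (j + suc k) (suc k) * q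
  exactly-r-lower j k r≤j 2d≤q q≤128d = begin
      d * q ^ d
    ≡⟨ cong (d *_) (^-distribˡ-+-* q j (suc k)) ⟩
      d * (q ^ j * (q * q ^ k))
    ≡⟨ regroup d (q ^ j) q (q ^ k) ⟩
      (d * q ^ k) * q ^ j * q
    ≤⟨ *-monoˡ-≤ q (*-mono-≤ dqᵏ≤ (pow-ratio-≤2 j (≤-trans (*-monoʳ-≤ 2 (m≤m+n j (suc k))) 2d≤q))) ⟩
      (d ^ suc k * 128 ^ k) * (2 * Q ^ j) * q
    ≤⟨ *-monoˡ-≤ q (*-monoˡ-≤ (2 * Q ^ j) (*-monoˡ-≤ (128 ^ k) dʳ≤)) ⟩
      (2 ^ suc k * suc j ^ suc k) * 128 ^ k * (2 * Q ^ j) * q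
    ≡⟨ cong (_* q) (regroup′ (2 ^ suc k) (suc j ^ suc k) (128 ^ k) (Q ^ j)) ⟩
      (2 ^ suc k * 2 * 128 ^ k) * (suc j ^ suc k * Q ^ j) * q
    ≤⟨ *-monoˡ-≤ q (*-monoʳ-≤ (2 ^ suc k * 2 * 128 ^ k) (bw-lower j (suc k))) ⟩
      (2 ^ suc k * 2 * 128 ^ k) * (suc k ! * bw d (suc k)) * q
    ≡⟨ cong (_* q) (regroup″ (2 ^ suc k) (128 ^ k) (suc k !) (bw d (suc k))) ⟩
      Kc k * bw d (suc k) * q
    ∎
    where
    open ≤-Reasoning
    d = j + suc k
    regroup : ∀ d a q b → d * (a * (q * b)) ≡ (d * b) * a * q
    regroup = solve-∀
    regroup′ : ∀ a b c x → a * b * c * (2 * x) ≡ a * 2 * c * (b * x)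
    regroup′ = solve-∀
    regroup″ : ∀ a c f h → a * 2 * c * (f * h) ≡ f * a * 2 * c * h
    regroup″ = solve-∀
    dqᵏ≤ : d * q ^ k ≤ d ^ suc k * 128 ^ k
    dqᵏ≤ = begin
      d * q ^ k             ≤⟨ *-monoʳ-≤ d (^-monoˡ-≤ k q≤128d) ⟩
      d * (128 * d) ^ k     ≡⟨ cong (d *_) (^-distribʳ-* 128 d k) ⟩
      d * (128 ^ k * d ^ k) ≡⟨ cong (d *_) (*-comm (128 ^ k) (d ^ k)) ⟩
      d * (d ^ k * 128 ^ k) ≡⟨ sym≡ (*-assoc d (d ^ k) (128 ^ k)) ⟩
      d * d ^ k * 128 ^ k   ∎
    d≤2[j+1] : d ≤ 2 * suc j
    d≤2[j+1] = begin
      j + suc k      ≤⟨ +-mono-≤ (n≤1+n j) (≤-trans r≤j (n≤1+n j)) ⟩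
      suc j + suc j  ≡⟨ cong (suc j +_) (sym≡ (+-identityʳ (suc j))) ⟩
      2 * suc j      ∎
    dʳ≤ : d ^ suc k ≤ 2 ^ suc k * suc j ^ suc k
    dʳ≤ = ≤-trans (^-monoˡ-≤ (suc k) d≤2[j+1]) (≤-reflexive (^-distribʳ-* 2 (suc j) (suc k)))

_⊆_ : ∀ {n} → (Fin n → Bool) → (Fin n → Bool) → Set
B ⊆ Y = ∀ v → B v ≡ true → Y v ≡ true

extend : ∀ {n} → Bool → (Fin n → Bool) → Fin (suc n) → Bool
extend b B zero    = b
extend b B (suc i) = B i

-- A subset B ⊆ Y gets weight Q^|Y∖B|;
-- with q = Q + 1 the weights sum to q^|Y| and describe the random subset
-- keeping each element of Y independently with probability 1/q.
-- wsum Y f is q^|Y| times the expectation of f(B).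
module BiasedSubsets (Q : ℕ) where
  open BinomialWeights Q public

  wsum : ∀ {n} → (Fin n → Bool) → ((Fin n → Bool) → ℕ) → ℕ
  wsum {zero}  Y f = f (λ ())
  wsum {suc n} Y f = if Y zero
    then wsum (λ i → Y (suc i)) (λ B → f (extend true B)) + Q * wsum (λ i → Y (suc i)) (λ B → f (extend false B))
    else wsum (λ i → Y (suc i)) (λ B → f (extend false B))

  wsum-cong : ∀ {n} (Y : Fin n → Bool) {f g : (Fin n → Bool) → ℕ} → (∀ B → f B ≡ g B) → wsum Y f ≡ wsum Y g
  wsum-cong {zero}  Y e = e _
  wsum-cong {suc n} Y e with Y zero
  ... | true  = cong₂ (λ a b → a + Q * b) (wsum-cong _ (λ B → e (extend true B))) (wsum-cong _ (λ B → e (extend false B)))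
  ... | false = wsum-cong _ (λ B → e (extend false B))

  wsum-+ : ∀ {n} (Y : Fin n → Bool) (f g : (Fin n → Bool) → ℕ) → wsum Y (λ B → f B + g B) ≡ wsum Y f + wsum Y g
  wsum-+ {zero}  Y f g = refl
  wsum-+ {suc n} Y f g with Y zero
  ... | false = wsum-+ (λ i → Y (suc i)) (λ B → f (extend false B)) (λ B → g (extend false B))
  ... | true  = trans (cong₂ (λ a b → a + Q * b) (wsum-+ Y′ (λ B → f (extend true B)) (λ B → g (extend true B)))
                                                 (wsum-+ Y′ (λ B → f (extend false B)) (λ B → g (extend false B))))
                      (interchange Q (wsum Y′ (λ B → f (extend true B))) (wsum Y′ (λ B → g (extend true B)))
                                     (wsum Y′ (λ B → f (extend false B))) (wsum Y′ (λ B → g (extend false B))))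
    where
    Y′ = λ i → Y (suc i)
    interchange : ∀ Q a b c d → (a + b) + Q * (c + d) ≡ (a + Q * c) + (b + Q * d)
    interchange = solve-∀

  wsum-*ˡ : ∀ {n} (Y : Fin n → Bool) (k : ℕ) (f : (Fin n → Bool) → ℕ) → wsum Y (λ B → k * f B) ≡ k * wsum Y f
  wsum-*ˡ {zero}  Y k f = refl
  wsum-*ˡ {suc n} Y k f with Y zero
  ... | false = wsum-*ˡ (λ i → Y (suc i)) k (λ B → f (extend false B))
  ... | true  = trans (cong₂ (λ a b → a + Q * b) (wsum-*ˡ Y′ k (λ B → f (extend true B))) (wsum-*ˡ Y′ k (λ B → f (extend false B))))
                      (factor Q k (wsum Y′ (λ B → f (extend true B))) (wsum Y′ (λ B → f (extend false B))))
    where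
    Y′ = λ i → Y (suc i)
    factor : ∀ Q k a b → k * a + Q * (k * b) ≡ k * (a + Q * b)
    factor = solve-∀

  wsum-sumFin : ∀ {n m} (Y : Fin n → Bool) (F : Fin m → (Fin n → Bool) → ℕ) →
    wsum Y (λ B → sumFin (λ x → F x B)) ≡ sumFin (λ x → wsum Y (F x))
  wsum-sumFin {m = zero}  Y F = wsum-*ˡ Y 0 (λ _ → 0)
  wsum-sumFin {m = suc m} Y F = trans (wsum-+ Y (F zero) (λ B → sumFin (λ x → F (suc x) B)))
    (cong (wsum Y (F zero) +_) (wsum-sumFin Y (λ x → F (suc x))))

  extend-witness : ∀ {n} {Y : Fin (suc n) → Bool} {g f : (Fin (suc n) → Bool) → ℕ} b →
    (b ≡ true → Y zero ≡ true) →
    Σ (Fin n → Bool) (λ B → (g (extend b B) < f (extend b B)) × B ⊆ (λ i → Y (suc i))) →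
    Σ (Fin (suc n) → Bool) λ B → (g B < f B) × B ⊆ Y
  extend-witness {Y = Y} b head (B , lt , B⊆) = extend b B , lt , ⊆Y
    where
    ⊆Y : extend b B ⊆ Y
    ⊆Y zero    e = head e
    ⊆Y (suc i) e = B⊆ i e

  averaging : ∀ {n} (Y : Fin n → Bool) (g f : (Fin n → Bool) → ℕ) → wsum Y g < wsum Y f →
              Σ (Fin n → Bool) λ B → (g B < f B) × B ⊆ Y
  averaging {zero}  Y g f g<f = (λ ()) , g<f , (λ ())
  averaging {suc n} Y g f g<f with Y zero in Y₀
  ... | false = extend-witness false (λ ()) (averaging (λ i → Y (suc i)) (g ∘ extend false) (f ∘ extend false) g<f)
  ... | true with wsum (λ i → Y (suc i)) (g ∘ extend true) <? wsum (λ i → Y (suc i)) (f ∘ extend true)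
  ...   | yes in< = extend-witness true (λ _ → Y₀) (averaging (λ i → Y (suc i)) (g ∘ extend true) (f ∘ extend true) in<)
  ...   | no  in≮ = extend-witness false (λ ()) (averaging (λ i → Y (suc i)) (g ∘ extend false) (f ∘ extend false) out<)
    where
    -- the excluded branch carries the surplus: a + Q·b < a′ + Q·b′ with a′ ≤ a gives b < b′
    out< : wsum (λ i → Y (suc i)) (g ∘ extend false) < wsum (λ i → Y (suc i)) (f ∘ extend false)
    out< = *-cancelˡ-< Q _ _ (+-cancelˡ-< _ _ _ (≤-<-trans (+-monoˡ-≤ _ (≮⇒≥ in≮)) g<f))

  wsum-one : ∀ {n} (Y : Fin n → Bool) → wsum Y (λ _ → 1) ≡ q ^ count Y
  wsum-one {zero}  Y = refl
  wsum-one {suc n} Y with Y zero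
  ... | true  rewrite wsum-one (λ i → Y (suc i)) = refl
  ... | false = wsum-one (λ i → Y (suc i))

  wsum-count : ∀ {n} (Y : Fin n → Bool) → wsum Y count * q ≡ count Y * q ^ count Y
  wsum-count {zero}  Y = refl
  wsum-count {suc n} Y with Y zero
  ... | false = wsum-count (λ i → Y (suc i))
  ... | true  = begin
      (wsum Y′ (λ B → 1 + count B) + Q * wsum Y′ count) * q
    ≡⟨ cong (λ z → (z + Q * wsum Y′ count) * q) (wsum-+ Y′ (λ _ → 1) count) ⟩
      (wsum Y′ (λ _ → 1) + wsum Y′ count + Q * wsum Y′ count) * q
    ≡⟨ expand (wsum Y′ (λ _ → 1)) (wsum Y′ count) Q ⟩
      wsum Y′ (λ _ → 1) * q + wsum Y′ count * q * q
    ≡⟨ cong₂ (λ a b → a * q + b * q) (wsum-one Y′) (wsum-count Y′) ⟩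
      q ^ count Y′ * q + count Y′ * q ^ count Y′ * q
    ≡⟨ collect (q ^ count Y′) (count Y′) Q ⟩
      suc (count Y′) * (q * q ^ count Y′)
    ∎
    where
    open ≡-Reasoning
    Y′ = λ i → Y (suc i)
    expand : ∀ a s Q → (a + s + Q * s) * suc Q ≡ a * suc Q + s * suc Q * suc Q
    expand = solve-∀
    collect : ∀ a m Q → a * suc Q + m * a * suc Q ≡ suc m * (suc Q * a)
    collect = solve-∀

  wsum-exactly : ∀ {n} (Y N : Fin n → Bool) (k : ℕ) →
    wsum Y (λ B → ind (count (λ u → N u ∧ B u) ≡ᵇ k))
      ≡ q ^ count (λ u → Y u ∧ not (N u)) * bw (count (λ u → Y u ∧ N u)) k
  wsum-exactly {zero}  Y N zero    = refl
  wsum-exactly {zero}  Y N (suc k) = refl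
  wsum-exactly {suc n} Y N k with Y zero | N zero
  ... | false | true  = wsum-exactly (λ i → Y (suc i)) (λ i → N (suc i)) k
  ... | false | false = wsum-exactly (λ i → Y (suc i)) (λ i → N (suc i)) k
  ... | true  | false = trans (cong₂ (λ a b → a + Q * b) (wsum-exactly Y′ N′ k) (wsum-exactly Y′ N′ k))
                             (collect (q ^ count (λ u → Y′ u ∧ not (N′ u))) (bw (count (λ u → Y′ u ∧ N′ u)) k) Q)
    where
    Y′ = λ i → Y (suc i)
    N′ = λ i → N (suc i)
    collect : ∀ x a Q → x * a + Q * (x * a) ≡ (suc Q * x) * a
    collect = solve-∀
  ... | true  | true with k
  ...   | zero   = trans (cong₂ (λ a b → a + Q * b) (wsum-*ˡ Y′ 0 (λ _ → 0)) (wsum-exactly Y′ N′ zero))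
                         (swap (q ^ count (λ u → Y′ u ∧ not (N′ u))) (bw (count (λ u → Y′ u ∧ N′ u)) zero) Q)
    where
    Y′ = λ i → Y (suc i)
    N′ = λ i → N (suc i)
    swap : ∀ x a Q → Q * (x * a) ≡ x * (Q * a)
    swap = solve-∀
  ...   | suc k′ = trans (cong₂ (λ a b → a + Q * b) (wsum-exactly Y′ N′ k′) (wsum-exactly Y′ N′ (suc k′)))
                         (factor (q ^ count (λ u → Y′ u ∧ not (N′ u))) (bw (count (λ u → Y′ u ∧ N′ u)) k′) (bw (count (λ u → Y′ u ∧ N′ u)) (suc k′)) Q)
    where
    Y′ = λ i → Y (suc i)
    N′ = λ i → N (suc i)
    factor : ∀ x a b Q → x * a + Q * (x * b) ≡ x * (a + Q * b)
    factor = solve-∀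

same : Bool → Bool → Bool
same true  b = b
same false b = not b

same-true : ∀ a b → same a b ≡ true → a ≡ b
same-true true  true  _ = refl
same-true false false _ = refl

same-not : ∀ a c → same a (not c) ≡ not (same a c)
same-not true  c = refl
same-not false c = refl

∧-elimˡ : ∀ {a b} → a ∧ b ≡ true → a ≡ true
∧-elimˡ {true} e = refl

∧-elimʳ : ∀ {a b} → a ∧ b ≡ true → b ≡ true
∧-elimʳ {true} e = e

module ColourClasses (G : Graph) (col : Fin (n G) → Bool)
                     (proper : ∀ u v → adj G u v ≡ true → col u ≢ col v) where

  V : Set
  V = Fin (n G)

  everything : V → Bool
  everything _ = true

  side : Bool → (V → Bool) → V → Bool
  side c S v = S v ∧ same (col v) c

  deg : Bool → (V → Bool) → V → ℕ
  deg c S x = count (λ u → side (not c) S u ∧ adj G x u)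

  edges : Bool → (V → Bool) → ℕ
  edges c S = sumFin (λ x → ind (side c S x) * deg c S x)

  same-colour-nonadjacent : ∀ u v → col u ≡ col v → adj G u v ≡ false
  same-colour-nonadjacent u v e with adj G u v in uv
  ... | true  = ⊥-elim (proper u v uv e)
  ... | false = refl

  opposite-classes-bipartition : ∀ c (A B : V → Bool) r →
    (∀ v → A v ≡ true → col v ≡ c) → (∀ v → B v ≡ true → col v ≡ not c) →
    1 ≤ count A → (∀ v → A v ≡ true → count (λ u → adj G v u ∧ B u) ≡ r) →
    IsInducedBipartition G A B × RegularSide G A B r
  opposite-classes-bipartition c A B r A⊆c B⊆c′ A≠∅ exactly =
    (disjoint , A-independent , B-independent) , A≠∅ , regular
    where
    disjoint : ∀ v → A v ≡ true → B v ≡ false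
    disjoint v av with B v in bv
    ... | true  = ⊥-elim (not-¬ {c} refl (trans (sym≡ (A⊆c v av)) (B⊆c′ v bv)))
    ... | false = refl
    A-independent : ∀ u v → A u ≡ true → A v ≡ true → adj G u v ≡ false
    A-independent u v au av = same-colour-nonadjacent u v (trans (A⊆c u au) (sym≡ (A⊆c v av)))
    B-independent : ∀ u v → B u ≡ true → B v ≡ true → adj G u v ≡ false
    B-independent u v bu bv = same-colour-nonadjacent u v (trans (B⊆c′ u bu) (sym≡ (B⊆c′ v bv)))
    -- a neighbour of v ∈ A inside A ∪ B lies in B
    regular : ∀ v → A v ≡ true → inducedDegree G (λ u → A u ∨ B u) v ≡ r
    regular v av = trans (count-cong only-B) (exactly v av)
      where
      only-B : ∀ u → (adj G v u ∧ (A u ∨ B u)) ≡ (adj G v u ∧ B u)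
      only-B u with A u in au
      ... | false = refl
      ... | true rewrite A-independent v u av au = refl

  edges-flip : ∀ c S → edges c S ≡ edges (not c) S
  edges-flip c S = begin
      sumFin (λ x → ind (side c S x) * deg c S x)
    ≡⟨ sumFin-cong (λ x → pairs c x) ⟩
      sumFin (λ x → sumFin (λ u → incident c x u))
    ≡⟨ sumFin-swap (incident c) ⟩
      sumFin (λ u → sumFin (λ x → incident c x u))
    ≡⟨ sumFin-cong (λ u → sumFin-cong (λ x → incident-sym x u)) ⟩
      sumFin (λ u → sumFin (λ x → incident (not c) u x))
    ≡⟨ sym≡ (sumFin-cong (λ x → pairs (not c) x)) ⟩
      sumFin (λ x → ind (side (not c) S x) * deg (not c) S x)
    ∎
    where
    open ≡-Reasoning
    incident : Bool → V → V → ℕ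
    incident c x u = ind (side c S x) * (ind (side (not c) S u) * ind (adj G x u))
    pairs : ∀ c x → ind (side c S x) * deg c S x ≡ sumFin (incident c x)
    pairs c x = begin
        ind (side c S x) * deg c S x
      ≡⟨ cong (ind (side c S x) *_) (count≡sumFin (λ u → side (not c) S u ∧ adj G x u)) ⟩
        ind (side c S x) * sumFin (λ u → ind (side (not c) S u ∧ adj G x u))
      ≡⟨ sym≡ (sumFin-*ˡ (ind (side c S x)) (λ u → ind (side (not c) S u ∧ adj G x u))) ⟩
        sumFin (λ u → ind (side c S x) * ind (side (not c) S u ∧ adj G x u))
      ≡⟨ sumFin-cong (λ u → cong (ind (side c S x) *_) (ind-∧ (side (not c) S u) (adj G x u))) ⟩
        sumFin (incident c x)
      ∎
    swap : ∀ a b c → a * (b * c) ≡ b * (a * c)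
    swap = solve-∀
    incident-sym : ∀ x u → incident c x u ≡ incident (not c) u x
    incident-sym x u rewrite not-involutive c | Graph.sym G x u =
      swap (ind (side c S x)) (ind (side (not c) S u)) (ind (adj G u x))

  edges-indep : ∀ c c′ S → edges c S ≡ edges c′ S
  edges-indep true  true  S = refl
  edges-indep false false S = refl
  edges-indep true  false S = edges-flip true S
  edges-indep false true  S = edges-flip false S

  count-sides : ∀ c S → count S ≡ count (side c S) + count (side (not c) S)
  count-sides c S = trans (count-split S (λ v → same (col v) c))
    (cong (count (side c S) +_) (count-cong λ v → cong (S v ∧_) (sym≡ (same-not (col v) c))))

  deg≤ : ∀ c S x → deg c S x ≤ count (side (not c) S)
  deg≤ c S x = count-mono {p = λ u → side (not c) S u ∧ adj G x u} (λ u → ∧-elimˡ)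

  edges≤ : ∀ c S → edges c S ≤ count (side c S) * count (side (not c) S)
  edges≤ c S = sum-over-≤ (side c S) (deg c S) (count (side (not c) S)) (λ x _ → deg≤ c S x)

  edges≤count² : ∀ c S → edges c S ≤ count S * count S
  edges≤count² c S = ≤-trans (edges≤ c S) (*-mono-≤ (≤-trans (m≤m+n x y) (≤-reflexive (sym≡ (count-sides c S))))
                                                    (≤-trans (m≤n+m y x) (≤-reflexive (sym≡ (count-sides c S)))))
    where
    x = count (side c S)
    y = count (side (not c) S)

  handshake : ∀ c → sumFin (degree G) ≡ 2 * edges c everything
  handshake c = begin
      sumFin (degree G)
    ≡⟨ sumFin-cong by-class ⟩
      sumFin (λ v → ind (side true everything v) * deg true everything v
                  + ind (side false everything v) * deg false everything v)
    ≡⟨ sumFin-+ (λ v → ind (side true everything v) * deg true everything v)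
                (λ v → ind (side false everything v) * deg false everything v) ⟩
      edges true everything + edges false everything
    ≡⟨ cong₂ _+_ (edges-indep true c everything) (edges-indep false c everything) ⟩
      edges c everything + edges c everything
    ≡⟨ cong (edges c everything +_) (sym≡ (+-identityʳ _)) ⟩
      2 * edges c everything
    ∎
    where
    open ≡-Reasoning
    neighbours : ∀ v u → adj G v u ≡ (same (col u) (not (col v)) ∧ adj G v u)
    neighbours v u with adj G v u in uv
    ... | false = sym≡ (∧-zeroʳ _)
    ... | true  = sym≡ (opposite (col u) (col v) (proper v u uv))
      where
      opposite : ∀ a b → b ≢ a → same a (not b) ∧ true ≡ true
      opposite true  true  ne = ⊥-elim (ne refl)
      opposite true  false ne = refl
      opposite false true  ne = refl
      opposite false false ne = ⊥-elim (ne refl)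
    by-class : ∀ v → degree G v ≡ ind (side true everything v) * deg true everything v
                                + ind (side false everything v) * deg false everything v
    by-class v with col v in cv
    ... | true  = trans (count-cong (λ u → trans (neighbours v u) (cong (λ z → same (col u) (not z) ∧ adj G v u) cv)))
                        (sym≡ (trans (+-identityʳ _) (*-identityˡ _)))
    ... | false = trans (count-cong (λ u → trans (neighbours v u) (cong (λ z → same (col u) (not z) ∧ adj G v u) cv)))
                        (sym≡ (*-identityˡ _))

  high : Bool → (V → Bool) → V → Bool
  high c S v = 8 * edges c S ≤ᵇ deg c S v * count S

  prune : Bool → (V → Bool) → V → Bool
  prune c S v = S v ∧ (not (same (col v) c) ∨ high c S v)

  side-prune : ∀ c S v → side c (prune c S) v ≡ (side c S v ∧ high c S v)
  side-prune c S v = kept (S v) (same (col v) c) (high c S v)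
    where
    kept : ∀ s a h → (s ∧ (not a ∨ h)) ∧ a ≡ (s ∧ a) ∧ h
    kept true  true  true  = refl
    kept true  true  false = refl
    kept true  false h = refl
    kept false a     h = refl

  side-prune-opposite : ∀ c S v → side (not c) (prune c S) v ≡ side (not c) S v
  side-prune-opposite c S v rewrite same-not (col v) c = kept (S v) (same (col v) c) (high c S v)
    where
    kept : ∀ s a h → (s ∧ (not a ∨ h)) ∧ not a ≡ s ∧ not a
    kept true  true  true  = refl
    kept true  true  false = refl
    kept true  false h = refl
    kept false a     h = refl

  deg-prune : ∀ c S x → deg c (prune c S) x ≡ deg c S x
  deg-prune c S x = count-cong (λ u → cong (_∧ adj G x u) (side-prune-opposite c S u))

  edges-prune : ∀ c S → edges c (prune c S) ≡ sumFin (λ x → ind (side c S x ∧ high c S x) * deg c S x)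
  edges-prune c S = sumFin-cong (λ x → cong₂ _*_ (cong ind (side-prune c S x)) (deg-prune c S x))

  edges-prune-≤ : ∀ c S → edges c (prune c S) ≤ edges c S
  edges-prune-≤ c S = ≤-trans (≤-reflexive (edges-prune c S))
    (sumFin-mono (λ x → *-monoˡ-≤ (deg c S x) (ind-∧≤ (side c S x) (high c S x))))
    where
    ind-∧≤ : ∀ a b → ind (a ∧ b) ≤ ind a
    ind-∧≤ true  true  = ≤-refl
    ind-∧≤ true  false = z≤n
    ind-∧≤ false b     = z≤n

  count-prune : ∀ c S → count (prune c S) ≡ count (λ x → side c S x ∧ high c S x) + count (side (not c) S)
  count-prune c S = trans (count-sides c (prune c S))
                          (cong₂ _+_ (count-cong (side-prune c S)) (count-cong (side-prune-opposite c S)))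

  record Stable (M : ℕ) (S : V → Bool) (c : Bool) : Set where
    field
      has-edge      : 1 ≤ edges c S
      dense         : M * count S ≤ edges c S
      larger        : count (side (not c) S) ≤ count (side c S)
      prune-sparser : edges c (prune c S) * count S ≤ edges c S * count (prune c S)

  prune-denser : ∀ M c S → M * count S ≤ edges c S →
    edges c S * count (prune c S) < edges c (prune c S) * count S →
    count (prune c S) < count S × 1 ≤ edges c (prune c S) × M * count (prune c S) ≤ edges c (prune c S)
  prune-denser M c S dense denser = smaller , has-edge , dense′
    where
    P : V → Bool
    P = prune c S
    smaller : count P < count S
    smaller = *-cancelˡ-< (edges c S) (count P) (count S)
                (<-≤-trans denser (*-monoˡ-≤ (count S) (edges-prune-≤ c S)))
    has-edge : 1 ≤ edges c P
    has-edge = positive-factor (edges c P) (≤-<-trans z≤n denser)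
      where
      positive-factor : ∀ a {b} → 0 < a * b → 1 ≤ a
      positive-factor (suc a) _ = s≤s z≤n
    rotate : ∀ a b c → a * b * c ≡ a * c * b
    rotate = solve-∀
    dense′ : M * count P ≤ edges c P
    dense′ = <⇒≤ (*-cancelʳ-< (count S) (M * count P) (edges c P)
               (≤-<-trans (≤-trans (≤-reflexive (rotate M (count P) (count S))) (*-monoˡ-≤ (count P) dense)) denser))

  orient : ∀ S → Σ Bool λ c → count (side (not c) S) ≤ count (side c S)
  orient S with count (side false S) ≤? count (side true S)
  ... | yes le = true , le
  ... | no  nle = false , <⇒≤ (≰⇒> nle)

  -- Pruning repeatedly while it increases the density ends in a stable set,
  -- since every pruning step strictly shrinks the set.
  densify : ∀ M fuel c S → count S ≤ fuel → 1 ≤ edges c S → M * count S ≤ edges c S →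
            Σ (V → Bool) λ S′ → Σ Bool λ c′ → Stable M S′ c′
  densify M zero c S S≤0 has-edge dense =
    ⊥-elim (<⇒≱ (≤-trans has-edge (edges≤count² c S)) (≤-reflexive (cong (λ z → z * z) (n≤0⇒n≡0 S≤0))))
  densify M (suc fuel) c₀ S S≤fuel has-edge₀ dense₀ with orient S
  ... | c , larger with edges c (prune c S) * count S ≤? edges c S * count (prune c S)
  ...   | yes sparser = S , c , record { has-edge = has-edge ; dense = dense ; larger = larger ; prune-sparser = sparser }
    where
    has-edge = ≤-trans has-edge₀ (≤-reflexive (edges-indep c₀ c S))
    dense    = ≤-trans dense₀ (≤-reflexive (edges-indep c₀ c S))
  ...   | no  denser with prune-denser M c S (≤-trans dense₀ (≤-reflexive (edges-indep c₀ c S))) (≰⇒> denser)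
  ...     | smaller , has-edge , dense = densify M fuel c (prune c S) (≤-pred (≤-trans smaller S≤fuel)) has-edge dense

-- The linear arithmetic behind the degree split: a total x + y splits into
-- a high part h ≤ p + y with 8p ≤ h, a low part l with 4l ≤ x, and a middle
-- part m; when y ≤ x, the middle part is at least 17/28 of y.
middle-share : ∀ p y x m h l → 8 * p ≤ h → h ≤ p + y → 4 * l ≤ x → y ≤ x →
               h + l + m ≡ x + y → 17 * y ≤ 28 * m
middle-share p y x m h l 8p≤h h≤p+y 4l≤x y≤x split = +-cancelʳ-≤ (28 * h + 28 * l) (17 * y) (28 * m) (begin
    17 * y + (28 * h + 28 * l)   ≤⟨ +-monoʳ-≤ (17 * y) (+-mono-≤ 28h≤32y 28l≤7x) ⟩
    17 * y + (32 * y + 7 * x)    ≡⟨ regroup y x ⟩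
    28 * y + 21 * y + 7 * x      ≤⟨ +-monoˡ-≤ (7 * x) (+-monoʳ-≤ (28 * y) (*-monoʳ-≤ 21 y≤x)) ⟩
    28 * y + 21 * x + 7 * x      ≡⟨ collect y x ⟩
    28 * (x + y)                 ≡⟨ cong (28 *_) (sym≡ split) ⟩
    28 * (h + l + m)             ≡⟨ expand h l m ⟩
    28 * m + (28 * h + 28 * l)   ∎)
  where
  open ≤-Reasoning
  regroup : ∀ y x → 17 * y + (32 * y + 7 * x) ≡ 28 * y + 21 * y + 7 * x
  regroup = solve-∀
  collect : ∀ y x → 28 * y + 21 * x + 7 * x ≡ 28 * (x + y)
  collect = solve-∀
  expand : ∀ h l m → 28 * (h + l + m) ≡ 28 * m + (28 * h + 28 * l)
  expand = solve-∀
  split-8 : ∀ p → 8 * p ≡ p + 7 * p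
  split-8 = solve-∀
  7p≤y : 7 * p ≤ y
  7p≤y = +-cancelˡ-≤ p (7 * p) y (≤-trans (≤-reflexive (sym≡ (split-8 p))) (≤-trans 8p≤h h≤p+y))
  28h≤32y : 28 * h ≤ 32 * y
  28h≤32y = begin
    28 * h              ≤⟨ *-monoʳ-≤ 28 h≤p+y ⟩
    28 * (p + y)        ≡⟨ expand′ p y ⟩
    4 * (7 * p) + 28 * y ≤⟨ +-monoˡ-≤ (28 * y) (*-monoʳ-≤ 4 7p≤y) ⟩
    4 * y + 28 * y      ≡⟨ collect′ y ⟩
    32 * y              ∎
    where
    expand′ : ∀ p y → 28 * (p + y) ≡ 4 * (7 * p) + 28 * y
    expand′ = solve-∀
    collect′ : ∀ y → 4 * y + 28 * y ≡ 32 * y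
    collect′ = solve-∀
  28l≤7x : 28 * l ≤ 7 * x
  28l≤7x = ≤-trans (≤-reflexive (*-assoc 7 4 l)) (*-monoʳ-≤ 7 4l≤x)

floor-div : ∀ E N → 1 ≤ N → Σ ℕ λ t → (t * N ≤ E) × (E < suc t * N)
floor-div E (suc N) _ = E / suc N , below , above
  where
  division : E ≡ E % suc N + (E / suc N) * suc N
  division = m≡m%n+[m/n]*n E (suc N)
  below : (E / suc N) * suc N ≤ E
  below = ≤-trans (m≤n+m _ (E % suc N)) (≤-reflexive (sym≡ division))
  above : E < suc (E / suc N) * suc N
  above = ≤-trans (≤-reflexive (cong suc division)) (+-monoˡ-≤ ((E / suc N) * suc N) (m%n<n E (suc N)))

Configuration : (G : Graph) → ℕ → ℕ → Set
Configuration G r lam = Σ (Fin (n G) → Bool) λ A → Σ (Fin (n G) → Bool) λ B →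
  IsInducedBipartition G A B × RegularSide G A B r × (lam * count B ≤ count A)

threshold : ℕ → ℕ → ℕ
threshold lam k = 2 * lam * Kc k + 8 * suc k + 1

module Construction (G : Graph) (col : Fin (n G) → Bool)
                    (proper : ∀ u v → adj G u v ≡ true → col u ≢ col v) (lam k : ℕ)
                    (S : Fin (n G) → Bool) (c : Bool)
                    (stable : ColourClasses.Stable G col proper (threshold lam k) S c) where
  open ColourClasses G col proper
  open Stable stable

  r M : ℕ
  r = suc k
  M = threshold lam k

  X Y : V → Bool
  X = side c S
  Y = side (not c) S

  E N x y : ℕ
  E = edges c S
  N = count S
  x = count X
  y = count Y

  d : V → ℕ
  d = deg c S

  low medium : V → Bool
  low v    = suc (d v * N * 4) ≤ᵇ E
  medium v = X v ∧ (not (high c S v) ∧ not (low v))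

  e-high e-low e-medium : ℕ
  e-high   = sumFin (λ v → ind (X v ∧ high c S v) * d v)
  e-low    = sumFin (λ v → ind (X v ∧ (not (high c S v) ∧ low v)) * d v)
  e-medium = sumFin (λ v → ind (medium v) * d v)

  edge-split : E ≡ e-high + e-low + e-medium
  edge-split = trans (sumFin-cong by-class)
    (trans (sumFin-+ (λ v → ind (X v ∧ high c S v) * d v + ind (X v ∧ (not (high c S v) ∧ low v)) * d v)
                     (λ v → ind (medium v) * d v))
           (cong (_+ e-medium) (sumFin-+ (λ v → ind (X v ∧ high c S v) * d v)
                                         (λ v → ind (X v ∧ (not (high c S v) ∧ low v)) * d v))))
    where
    trichotomy : ∀ a h l → ind a ≡ ind (a ∧ h) + ind (a ∧ (not h ∧ l)) + ind (a ∧ (not h ∧ not l))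
    trichotomy false h     l     = refl
    trichotomy true  true  l     = refl
    trichotomy true  false true  = refl
    trichotomy true  false false = refl
    distrib : ∀ i j k e → (i + j + k) * e ≡ i * e + j * e + k * e
    distrib = solve-∀
    by-class : ∀ v → ind (X v) * d v ≡ ind (X v ∧ high c S v) * d v
                                       + ind (X v ∧ (not (high c S v) ∧ low v)) * d v + ind (medium v) * d v
    by-class v rewrite trichotomy (X v) (high c S v) (low v) =
      distrib (ind (X v ∧ high c S v)) (ind (X v ∧ (not (high c S v) ∧ low v))) (ind (medium v)) (d v)

  N≡x+y : N ≡ x + y
  N≡x+y = count-sides c S

  y≥1 : 1 ≤ y
  y≥1 = positive-right x y (≤-trans has-edge (edges≤ c S))
    where
    positive-right : ∀ a b → 1 ≤ a * b → 1 ≤ b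
    positive-right a zero    h = ≤-trans h (≤-reflexive (*-zeroʳ a))
    positive-right a (suc b) h = s≤s z≤n

  N≥1 : 1 ≤ N
  N≥1 = ≤-trans y≥1 (≤-trans (m≤n+m y x) (≤-reflexive (sym≡ N≡x+y)))

  instance
    N≢0 : NonZero N
    N≢0 = >-nonZero N≥1

  -- high vertices have large degree, so there are few of them: 8E·a ≤ N·e-high
  high-edges-≥ : 8 * (E * count (λ v → X v ∧ high c S v)) ≤ N * e-high
  high-edges-≥ = begin
      8 * (E * a)
    ≡⟨ rearrange E a ⟩
      a * (8 * E)
    ≤⟨ sum-over-≥ (λ v → X v ∧ high c S v) (λ v → d v * N) (8 * E) (λ v hv → ≤ᵇ⇒≤′ (∧-elimʳ hv)) ⟩
      sumFin (λ v → ind (X v ∧ high c S v) * (d v * N))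
    ≡⟨ sumFin-cong (λ v → sym≡ (*-assoc (ind (X v ∧ high c S v)) (d v) N)) ⟩
      sumFin (λ v → ind (X v ∧ high c S v) * d v * N)
    ≡⟨ sumFin-*ʳ N (λ v → ind (X v ∧ high c S v) * d v) ⟩
      e-high * N
    ≡⟨ *-comm e-high N ⟩
      N * e-high
    ∎
    where
    open ≤-Reasoning
    a = count (λ v → X v ∧ high c S v)
    rearrange : ∀ E a → 8 * (E * a) ≡ a * (8 * E)
    rearrange = solve-∀
    ≤ᵇ⇒≤′ : ∀ {m n} → (m ≤ᵇ n) ≡ true → m ≤ n
    ≤ᵇ⇒≤′ {m} {n} e = ≤ᵇ⇒≤ m n (subst T (sym≡ e) tt)

  -- stability: pruning to the high vertices does not raise the density
  high-edges-≤ : N * e-high ≤ E * count (λ v → X v ∧ high c S v) + E * y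
  high-edges-≤ = begin
      N * e-high
    ≡⟨ *-comm N e-high ⟩
      e-high * N
    ≡⟨ cong (_* N) (sym≡ (edges-prune c S)) ⟩
      edges c (prune c S) * N
    ≤⟨ prune-sparser ⟩
      E * count (prune c S)
    ≡⟨ cong (E *_) (count-prune c S) ⟩
      E * (count (λ v → X v ∧ high c S v) + y)
    ≡⟨ *-distribˡ-+ E (count (λ v → X v ∧ high c S v)) y ⟩
      E * count (λ v → X v ∧ high c S v) + E * y
    ∎
    where open ≤-Reasoning

  -- low vertices have degree < E/(4N): 4N·e-low ≤ E·x
  low-edges-≤ : 4 * (N * e-low) ≤ E * x
  low-edges-≤ = begin
      4 * (N * e-low)
    ≡⟨ rearrange N e-low ⟩
      e-low * (N * 4)
    ≡⟨ sym≡ (sumFin-*ʳ (N * 4) (λ v → ind (is-low v) * d v)) ⟩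
      sumFin (λ v → ind (is-low v) * d v * (N * 4))
    ≡⟨ sumFin-cong (λ v → rearrange′ (ind (is-low v)) (d v) N) ⟩
      sumFin (λ v → ind (is-low v) * (d v * N * 4))
    ≤⟨ sum-over-≤ is-low (λ v → d v * N * 4) E (λ v lv → <⇒≤ (<ᵇ⇒<′ (∧-elimʳ (∧-elimʳ {X v} lv)))) ⟩
      count is-low * E
    ≤⟨ *-monoˡ-≤ E (count-mono {p = is-low} (λ v → ∧-elimˡ)) ⟩
      x * E
    ≡⟨ *-comm x E ⟩
      E * x
    ∎
    where
    open ≤-Reasoning
    is-low : V → Bool
    is-low v = X v ∧ (not (high c S v) ∧ low v)
    rearrange : ∀ N e → 4 * (N * e) ≡ e * (N * 4)
    rearrange = solve-∀
    rearrange′ : ∀ i d N → i * d * (N * 4) ≡ i * (d * N * 4)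
    rearrange′ = solve-∀
    <ᵇ⇒<′ : ∀ {m n} → (suc m ≤ᵇ n) ≡ true → m < n
    <ᵇ⇒<′ {m} {n} e = ≤ᵇ⇒≤ (suc m) n (subst T (sym≡ e) tt)

  split-scaled : N * e-high + N * e-low + N * e-medium ≡ E * x + E * y
  split-scaled = begin
      N * e-high + N * e-low + N * e-medium
    ≡⟨ factor N e-high e-low e-medium ⟩
      (e-high + e-low + e-medium) * N
    ≡⟨ cong (_* N) (sym≡ edge-split) ⟩
      E * N
    ≡⟨ cong (E *_) N≡x+y ⟩
      E * (x + y)
    ≡⟨ *-distribˡ-+ E x y ⟩
      E * x + E * y
    ∎
    where
    open ≡-Reasoning
    factor : ∀ N a b c → N * a + N * b + N * c ≡ (a + b + c) * N
    factor = solve-∀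

  medium-edges-≥ : 17 * (E * y) ≤ 28 * (N * e-medium)
  medium-edges-≥ = middle-share (E * count (λ v → X v ∧ high c S v)) (E * y) (E * x) (N * e-medium) (N * e-high) (N * e-low)
                     high-edges-≥ high-edges-≤ low-edges-≤ (*-monoʳ-≤ E larger) split-scaled

  medium-edges-large : lam * Kc k * y < e-medium
  medium-edges-large = *-cancelˡ-< N (lam * Kc k * y) e-medium
    (*-cancelˡ-< 28 (N * (lam * Kc k * y)) (N * e-medium) (<-≤-trans below (≤-trans via-density medium-edges-≥)))
    where
    Ny≥1 : 1 ≤ N * y
    Ny≥1 = *-mono-≤ N≥1 y≥1
    rest : ℕ
    rest = 6 * (lam * Kc k * (N * y)) + 17 * ((8 * r + 1) * (N * y))
    rest≥1 : 1 ≤ rest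
    rest≥1 = ≤-trans (*-mono-≤ (s≤s (z≤n {16})) (*-mono-≤ (m≤n+m 1 (8 * r)) Ny≥1)) (m≤n+m _ (6 * (lam * Kc k * (N * y))))
    expand : ∀ l K s N y → 17 * ((2 * l * K + s + 1) * N * y)
                          ≡ 28 * (N * (l * K * y)) + (6 * (l * K * (N * y)) + 17 * ((s + 1) * (N * y)))
    expand = solve-∀
    below : 28 * (N * (lam * Kc k * y)) < 17 * (M * N * y)
    below = <-≤-trans (m<m+n _ rest≥1) (≤-reflexive (sym≡ (expand lam (Kc k) (8 * r) N y)))
    via-density : 17 * (M * N * y) ≤ 17 * (E * y)
    via-density = *-monoʳ-≤ 17 (*-monoˡ-≤ y dense)

  N≤E : N ≤ E
  N≤E = ≤-trans (≤-reflexive (sym≡ (*-identityˡ N))) (≤-trans (*-monoˡ-≤ N (m≤n+m 1 (2 * lam * Kc k + 8 * r))) dense)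

  -- The sampling rate q = 16(t + 1) with t = ⌊E/N⌋, so that 16E < q·N ≤ 32E.
  t : ℕ
  t = proj₁ (floor-div E N N≥1)

  open BiasedSubsets (15 + 16 * t)

  qN≡ : q * N ≡ 16 * (suc t * N)
  qN≡ = expand t N
    where
    expand : ∀ t N → suc (15 + 16 * t) * N ≡ 16 * (suc t * N)
    expand = solve-∀

  16E<qN : 16 * E < q * N
  16E<qN = <-≤-trans (*-monoʳ-< 16 (proj₂ (proj₂ (floor-div E N N≥1)))) (≤-reflexive (sym≡ qN≡))

  qN≤32E : q * N ≤ 32 * E
  qN≤32E = begin
      q * N
    ≡⟨ qN≡ ⟩
      16 * (N + t * N)
    ≤⟨ *-monoʳ-≤ 16 (+-mono-≤ N≤E (proj₁ (proj₂ (floor-div E N N≥1)))) ⟩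
      16 * (E + E)
    ≡⟨ double E ⟩
      32 * E
    ∎
    where
    open ≤-Reasoning
    double : ∀ E → 16 * (E + E) ≡ 32 * E
    double = solve-∀

  -- A medium vertex has degree d with 2d < q ≤ 128d and 2r ≤ d, so it gets
  -- exactly r neighbours in B with probability at least d/(Kc·q).
  module MediumVertex (v : V) (med : medium v ≡ true) where
    not-true : ∀ {b} → not b ≡ true → b ≡ false
    not-true {false} _ = refl

    below-high : d v * N < 8 * E
    below-high = ≰⇒> (λ le → subst T (not-true (∧-elimˡ (∧-elimʳ {X v} med))) (≤⇒≤ᵇ le))

    above-low : E ≤ d v * N * 4
    above-low = ≮⇒≥ (λ lt → subst T (not-true (∧-elimʳ {not (high c S v)} (∧-elimʳ {X v} med))) (≤⇒≤ᵇ lt))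

    2d<q : 2 * d v < q
    2d<q = *-cancelʳ-< N (2 * d v) q (begin-strict
        2 * d v * N     ≡⟨ *-assoc 2 (d v) N ⟩
        2 * (d v * N)   <⟨ *-monoʳ-< 2 below-high ⟩
        2 * (8 * E)     ≡⟨ sym≡ (*-assoc 2 8 E) ⟩
        16 * E          <⟨ 16E<qN ⟩
        q * N           ∎)
      where open ≤-Reasoning

    q≤128d : q ≤ 128 * d v
    q≤128d = *-cancelʳ-≤ q (128 * d v) N (begin
        q * N                ≤⟨ qN≤32E ⟩
        32 * E               ≤⟨ *-monoʳ-≤ 32 above-low ⟩
        32 * (d v * N * 4)   ≡⟨ rearrange (d v) N ⟩
        128 * d v * N        ∎)
      where
      open ≤-Reasoning
      rearrange : ∀ d N → 32 * (d * N * 4) ≡ 128 * d * N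
      rearrange = solve-∀

    2r≤d : 2 * r ≤ d v
    2r≤d = *-cancelˡ-≤ 4 (*-cancelʳ-≤ (4 * (2 * r)) (4 * d v) N (begin
        4 * (2 * r) * N                 ≡⟨ cong (_* N) (*-assoc 4 2 r) ⟨
        8 * r * N                       ≤⟨ *-monoˡ-≤ N (≤-trans (m≤m+n (8 * r) 1) (m≤n+m _ (2 * lam * Kc k))) ⟩
        (2 * lam * Kc k + (8 * r + 1)) * N ≡⟨ cong (_* N) (sym≡ (+-assoc (2 * lam * Kc k) (8 * r) 1)) ⟩
        M * N                           ≤⟨ dense ⟩
        E                               ≤⟨ above-low ⟩
        d v * N * 4                     ≡⟨ rearrange (d v) N ⟩
        4 * d v * N                     ∎))
      where
      open ≤-Reasoning
      rearrange : ∀ d N → d * N * 4 ≡ 4 * d * N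
      rearrange = solve-∀

    exactly-r : d v * q ^ d v ≤ Kc k * bw (d v) r * q
    exactly-r = subst (λ z → z * q ^ z ≤ Kc k * bw z r * q) (m∸n+n≡m r≤d)
      (exactly-r-lower j k r≤j (subst (λ z → 2 * z ≤ q) d≡j+r (<⇒≤ 2d<q)) (subst (λ z → q ≤ 128 * z) d≡j+r q≤128d))
      where
      r≤d : r ≤ d v
      r≤d = ≤-trans (m≤m+n r (r + 0)) 2r≤d
      j = d v ∸ r
      d≡j+r : d v ≡ j + r
      d≡j+r = sym≡ (m∸n+n≡m r≤d)
      r≤j : r ≤ j
      r≤j = +-cancelʳ-≤ r r j (≤-trans (≤-reflexive (cong (r +_) (sym≡ (+-identityʳ r))))
                                        (≤-trans 2r≤d (≤-reflexive d≡j+r)))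

  has-r : V → (V → Bool) → Bool
  has-r v B = count (λ u → adj G v u ∧ B u) ≡ᵇ r

  hits : V → ℕ
  hits v = wsum Y (λ B → ind (has-r v B))

  medium-hits : ∀ v → medium v ≡ true → d v * q ^ y ≤ Kc k * hits v * q
  medium-hits v med = begin
      d v * q ^ y
    ≡⟨ cong (λ z → d v * q ^ z) (count-split Y (adj G v)) ⟩
      d v * q ^ (d v + rest)
    ≡⟨ cong (d v *_) (^-distribˡ-+-* q (d v) rest) ⟩
      d v * (q ^ d v * q ^ rest)
    ≡⟨ rearrange (d v) (q ^ d v) (q ^ rest) ⟩
      q ^ rest * (d v * q ^ d v)
    ≤⟨ *-monoʳ-≤ (q ^ rest) (MediumVertex.exactly-r v med) ⟩
      q ^ rest * (Kc k * bw (d v) r * q)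
    ≡⟨ rearrange′ (q ^ rest) (Kc k) (bw (d v) r) q ⟩
      Kc k * (q ^ rest * bw (d v) r) * q
    ≡⟨ cong (λ z → Kc k * z * q) (sym≡ (wsum-exactly Y (adj G v) r)) ⟩
      Kc k * hits v * q
    ∎
    where
    open ≤-Reasoning
    rest = count (λ u → Y u ∧ not (adj G v u))
    rearrange : ∀ d a b → d * (a * b) ≡ b * (d * a)
    rearrange = solve-∀
    rearrange′ : ∀ a K h q → a * (K * h * q) ≡ K * (a * h) * q
    rearrange′ = solve-∀

  good : (V → Bool) → V → Bool
  good B v = medium v ∧ has-r v B

  expected-good : wsum Y (λ B → count (good B)) ≡ sumFin (λ v → ind (medium v) * hits v)
  expected-good = begin
      wsum Y (λ B → count (good B))
    ≡⟨ wsum-cong Y (λ B → trans (count≡sumFin (good B)) (sumFin-cong (λ v → ind-∧ (medium v) (has-r v B)))) ⟩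
      wsum Y (λ B → sumFin (λ v → ind (medium v) * ind (has-r v B)))
    ≡⟨ wsum-sumFin Y (λ v B → ind (medium v) * ind (has-r v B)) ⟩
      sumFin (λ v → wsum Y (λ B → ind (medium v) * ind (has-r v B)))
    ≡⟨ sumFin-cong (λ v → wsum-*ˡ Y (ind (medium v)) (λ B → ind (has-r v B))) ⟩
      sumFin (λ v → ind (medium v) * hits v)
    ∎
    where open ≡-Reasoning

  good-lower : e-medium * q ^ y ≤ wsum Y (λ B → count (good B)) * (Kc k * q)
  good-lower = begin
      e-medium * q ^ y
    ≡⟨ sym≡ (sumFin-*ʳ (q ^ y) (λ v → ind (medium v) * d v)) ⟩
      sumFin (λ v → ind (medium v) * d v * q ^ y)
    ≡⟨ sumFin-cong (λ v → *-assoc (ind (medium v)) (d v) (q ^ y)) ⟩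
      sumFin (λ v → ind (medium v) * (d v * q ^ y))
    ≤⟨ sumFin-mono at-medium ⟩
      sumFin (λ v → ind (medium v) * (Kc k * hits v * q))
    ≡⟨ sumFin-cong (λ v → rearrange (ind (medium v)) (Kc k) (hits v) q) ⟩
      sumFin (λ v → ind (medium v) * hits v * (Kc k * q))
    ≡⟨ sumFin-*ʳ (Kc k * q) (λ v → ind (medium v) * hits v) ⟩
      sumFin (λ v → ind (medium v) * hits v) * (Kc k * q)
    ≡⟨ cong (_* (Kc k * q)) (sym≡ expected-good) ⟩
      wsum Y (λ B → count (good B)) * (Kc k * q)
    ∎
    where
    open ≤-Reasoning
    rearrange : ∀ i K g q → i * (K * g * q) ≡ i * g * (K * q)
    rearrange = solve-∀
    at-medium : ∀ v → ind (medium v) * (d v * q ^ y) ≤ ind (medium v) * (Kc k * hits v * q)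
    at-medium v with medium v in med
    ... | true  = *-monoʳ-≤ 1 (medium-hits v med)
    ... | false = z≤n

  size-upper : wsum Y (λ B → lam * count B) * (Kc k * q) ≡ lam * Kc k * y * q ^ y
  size-upper = begin
      wsum Y (λ B → lam * count B) * (Kc k * q)
    ≡⟨ cong (_* (Kc k * q)) (wsum-*ˡ Y lam count) ⟩
      lam * wsum Y count * (Kc k * q)
    ≡⟨ rearrange lam (wsum Y count) (Kc k) q ⟩
      lam * Kc k * (wsum Y count * q)
    ≡⟨ cong (lam * Kc k *_) (wsum-count Y) ⟩
      lam * Kc k * (y * q ^ y)
    ≡⟨ sym≡ (*-assoc (lam * Kc k) y (q ^ y)) ⟩
      lam * Kc k * y * q ^ y
    ∎
    where
    open ≡-Reasoning
    rearrange : ∀ l s K q → l * s * (K * q) ≡ l * K * (s * q)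
    rearrange = solve-∀

  expectation-gap : wsum Y (λ B → lam * count B) < wsum Y (λ B → count (good B))
  expectation-gap = *-cancelʳ-< (Kc k * q) _ _ (begin-strict
      wsum Y (λ B → lam * count B) * (Kc k * q)   ≡⟨ size-upper ⟩
      lam * Kc k * y * q ^ y                       <⟨ *-monoˡ-< (q ^ y) {{m^n≢0 q y}} medium-edges-large ⟩
      e-medium * q ^ y                             ≤⟨ good-lower ⟩
      wsum Y (λ B → count (good B)) * (Kc k * q)  ∎)
    where open ≤-Reasoning

  -- Some subset B of Y realises the gap (kept abstract, so that it is never unfolded).
  abstract
    sample : Σ (V → Bool) λ B → (lam * count B < count (good B)) × B ⊆ Y
    sample = averaging Y (λ B → lam * count B) (λ B → count (good B)) expectation-gap

  B : V → Bool
  B = proj₁ sample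

  configuration : Configuration G r lam
  configuration = good B , B , proj₁ bipartite , proj₂ bipartite , <⇒≤ gap
    where
    gap : lam * count B < count (good B)
    gap = proj₁ (proj₂ sample)
    A-colour : ∀ v → good B v ≡ true → col v ≡ c
    A-colour v gv = same-true (col v) c (∧-elimʳ {S v} (∧-elimˡ {X v} (∧-elimˡ {medium v} gv)))
    B-colour : ∀ v → B v ≡ true → col v ≡ not c
    B-colour v bv = same-true (col v) (not c) (∧-elimʳ {S v} (proj₂ (proj₂ sample) v bv))
    exactly : ∀ v → good B v ≡ true → count (λ u → adj G v u ∧ B u) ≡ r
    exactly v gv = ≡ᵇ⇒≡ (count (λ u → adj G v u ∧ B u)) r (subst T (sym≡ (∧-elimʳ {medium v} gv)) tt)
    bipartite : IsInducedBipartition G (good B) B × RegularSide G (good B) B r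
    bipartite = opposite-classes-bipartition c (good B) B r A-colour B-colour (≤-trans (s≤s z≤n) gap) exactly

single-vertex : ∀ lam (G : Graph) (col : Fin (n G) → Bool) →
  (proper : ∀ u v → adj G u v ≡ true → col u ≢ col v) → 1 ≤ n G → Configuration G 0 lam
single-vertex lam G col proper n≥1 = A , (λ _ → false) , proj₁ bipartite , proj₂ bipartite , B-empty
  where
  open ColourClasses G col proper
  v₀ : V
  v₀ = fromℕ< n≥1
  A : V → Bool
  A v = does (v ≟ v₀)
  A-is-v₀ : ∀ v → A v ≡ true → v ≡ v₀
  A-is-v₀ v av with v ≟ v₀
  ... | yes v≡v₀ = v≡v₀
  A-nonempty : 1 ≤ count A
  A-nonempty = count-pos A v₀ (dec-true (v₀ ≟ v₀) refl)
  bipartite : IsInducedBipartition G A (λ _ → false) × RegularSide G A (λ _ → false) 0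
  bipartite = opposite-classes-bipartition (col v₀) A (λ _ → false) 0
    (λ v av → cong col (A-is-v₀ v av)) (λ v ()) A-nonempty
    (λ v _ → trans (count-cong (λ u → ∧-zeroʳ (adj G v u))) (count-none {n G}))
  B-empty : lam * count {n G} (λ _ → false) ≤ count A
  B-empty = ≤-trans (≤-reflexive (trans (cong (lam *_) (count-none {n G})) (*-zeroʳ lam))) z≤n

-- r = k + 1: average degree ≥ 2M gives at least M·|V| edges; densifying
-- yields an M-stable set, in which the construction applies.
dense-configuration : ∀ lam k (G : Graph) (col : Fin (n G) → Bool) →
  (proper : ∀ u v → adj G u v ≡ true → col u ≢ col v) →
  AvgDegreeAtLeast G (2 * threshold lam k) → Configuration G (suc k) lam
dense-configuration lam k G col proper (n≥1 , degree-sum) =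
  from-stable (densify M (n G) true everything (≤-reflexive (count-all {n G})) has-edge dense)
  where
  open ColourClasses G col proper
  M = threshold lam k
  dense′ : M * n G ≤ edges true everything
  dense′ = *-cancelˡ-≤ 2 (≤-trans (≤-reflexive (sym≡ (*-assoc 2 M (n G))))
                                  (≤-trans degree-sum (≤-reflexive (handshake true))))
  dense : M * count everything ≤ edges true everything
  dense = ≤-trans (≤-reflexive (cong (M *_) (count-all {n G}))) dense′
  has-edge : 1 ≤ edges true everything
  has-edge = ≤-trans (*-mono-≤ (m≤n+m 1 (2 * lam * Kc k + 8 * suc k)) n≥1) dense′
  from-stable : (Σ (V → Bool) λ S → Σ Bool λ c → Stable M S c) → Configuration G (suc k) lam
  from-stable (S , c , stable) = Construction.configuration G col proper lam k S c stable

D : ℕ → ℕ → ℕ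
D zero    lam = 0
D (suc k) lam = 2 * threshold lam k

lemma3p1 : Σ (ℕ → ℕ → ℕ) λ D →
    (r lam : ℕ) → (G : Graph) → IsBipartite G → AvgDegreeAtLeast G (D r lam) →
    Σ (Fin (n G) → Bool) λ A → Σ (Fin (n G) → Bool) λ B →
    IsInducedBipartition G A B × RegularSide G A B r × (lam * count B ≤ count A)
lemma3p1 = D , configuration
  where
  configuration : (r lam : ℕ) → (G : Graph) → IsBipartite G → AvgDegreeAtLeast G (D r lam) →
                  Configuration G r lam
  configuration zero    lam G (col , proper) (n≥1 , _) = single-vertex lam G col proper n≥1
  configuration (suc k) lam G (col , proper) avg       = dense-configuration lam k G col proper avg
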